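{- Let $\mathcal{T}=(T,\mathsf{bag})$ be a regular tree decomposition of a graph $G$ of adhesion $a$. Suppose further that $G$ is $K_t$-topological-minor-free. Then for each $x\in V(T)$, the graph $\mathsf{bgraph}(x)$ is $K_{t'}$-topological-minor-free, where $t'=\max(t,a+2)$.
   Context: A tree decomposition $\mathcal T=(T,\mathsf{bag})$ of $G$ consists of a rooted tree $T$ and $\mathsf{bag}:V(T)\to 2^{V(G)}$ such that for each vertex $u$ the nodes whose bags contain $u$ induce a nonempty connected subtree, and each edge of $G$ lies in some bag. For a node $x$ with parent $p$ (and $\mathsf{bag}(p)=\emptyset$ if $x$ is the root): $\mathsf{adh}(x)=\mathsf{bag}(p)\cap\mathsf{bag}(x)$; $\mathsf{mrg}(x)=\mathsf{bag}(x)\setminus\mathsf{adh}(x)$; $\mathsf{cone}(x)$ is the union of bags of all descendants of $x$ (including $x$); $\mathsf{comp}(x)=\mathsf{cone}(x)\setminus\mathsf{adh}(x)$. The adhesion of $\mathcal T$ is $\max_x|\mathsf{adh}(x)|$. $\mathcal T$ is regular if for every non-root node $x$: $\mathsf{mrg}(x)\neq\emptyset$, $G[\mathsf{comp}(x)]$ is connected, and every vertex of $\mathsf{adh}(x)$ has a neighbor in $\mathsf{comp}(x)$. The bag graph $\mathsf{bgraph}(x)$ has vertex set the disjoint union of $\mathsf{bag}(x)$ and the set of children of $x$; $u,v\in\mathsf{bag}(x)$ are adjacent iff adjacent in $G$; $u\in\mathsf{bag}(x)$ and a child $y$ are adjacent iff $u$ has a neighbor in $\mathsf{comp}(y)$;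 no two children are adjacent. A graph is $H$-topological-minor-free if there is no injective map sending vertices of $H$ to vertices of the graph and edges $uv$ of $H$ to pairwise internally vertex-disjoint paths joining the images of $u$ and $v$. -}

module Defs where

open import Data.Nat using (ℕ; _<_; _≤_)
open import Data.Fin using (Fin)
open import Data.Fin.Subset using (Subset; _∈_; _∩_; ⊥; ∣_∣)
open import Data.Maybe using (Maybe; just; nothing)
open import Data.List using (List; []; _∷_)
open import Data.List.Relation.Unary.Unique.Propositional using (Unique)
import Data.List.Membership.Propositional as LM
open import Data.Product using (Σ; ∃; _×_; _,_)
open import Data.Sum using (_⊎_; inj₁; inj₂)
open import Data.Empty renaming (⊥ to Empty)
open import Relation.Nullary using (¬_)
open import Relation.Binary.PropositionalEquality using (_≡_; _≢_)
open import Function.Definitions using (Injective)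

data Walk {V : Set} (E : V → V → Set) : V → V → Set where
  [_] : (v : V) → Walk E v v
  _∷_ : ∀ {u v w} → E u v → Walk E v w → Walk E u w

vertices : ∀ {V E} {u w : V} → Walk E u w → List V
vertices [ v ] = v ∷ []
vertices (_∷_ {u = u} e p) = u ∷ vertices p

exceptLast : ∀ {V E} {u w : V} → Walk E u w → List V
exceptLast [ v ] = []
exceptLast (_∷_ {u = u} e p) = u ∷ exceptLast p

interior : ∀ {V E} {u w : V} → Walk E u w → List V
interior [ v ] = []
interior (e ∷ p) = exceptLast p

IsPath : ∀ {V E} {u w : V} → Walk E u w → Set
IsPath p = Unique (vertices p)

-- An injective map f from the vertices of K_t (= Fin t) into V, and for
-- every edge {i,j} of K_t (encoded as i < j) a path from f i to f j, such
-- that the paths are pairwise internally vertex-disjoint: no internal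
-- vertex of one path lies on another path.

record KTopMinor {V : Set} (E : V → V → Set) (t : ℕ) : Set where
  field
    branch      : Fin t → V
    injective   : Injective _≡_ _≡_ branch
    path        : (i j : Fin t) → Data.Fin._<_ i j → Walk E (branch i) (branch j)
    isPath      : ∀ i j (i<j : Data.Fin._<_ i j) → IsPath (path i j i<j)
    disjoint    : ∀ i j i' j' (i<j : Data.Fin._<_ i j) (i'<j' : Data.Fin._<_ i' j') →
                  ¬ ((i ≡ i') × (j ≡ j')) →
                  ∀ z → LM._∈_ z (interior (path i j i<j)) →
                        ¬ LM._∈_ z (vertices (path i' j' i'<j'))

TopMinorFree : {V : Set} (E : V → V → Set) (t : ℕ) → Set
TopMinorFree E t = ¬ KTopMinor E t

-- Desc parent y x : y is a descendant of x (reflexive).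
data Desc {m : ℕ} (parent : Fin m → Maybe (Fin m)) : Fin m → Fin m → Set where
  here  : ∀ {x} → Desc parent x x
  there : ∀ {y z x} → parent y ≡ just z → Desc parent z x → Desc parent y x

record RootedTree (m : ℕ) : Set where
  field
    parent      : Fin m → Maybe (Fin m)
    root        : Fin m
    root-parent : parent root ≡ nothing
    root-unique : ∀ x → parent x ≡ nothing → x ≡ root
    reach-root  : ∀ x → Desc parent x root   -- acyclicity / connectivity

  EdgeIn : (Fin m → Set) → Fin m → Fin m → Set
  EdgeIn S x y = S x × S y × (parent x ≡ just y ⊎ parent y ≡ just x)

open RootedTree public

module _ {n m : ℕ} (E : Fin n → Fin n → Set) (T : RootedTree m)
         (bag : Fin m → Subset n) where

  record IsTreeDecomposition : Set where
    field
      nonempty  : ∀ u → ∃ λ x → u ∈ bag x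
      connected : ∀ u x y → u ∈ bag x → u ∈ bag y →
                  Walk (EdgeIn T (λ z → u ∈ bag z)) x y
      edges     : ∀ u v → E u v → ∃ λ x → (u ∈ bag x) × (v ∈ bag x)

  adh : Fin m → Subset n
  adh x with parent T x
  ... | nothing = ⊥
  ... | just p  = bag p ∩ bag x

  mrg : Fin m → Fin n → Set
  mrg x v = v ∈ bag x × ¬ (v ∈ adh x)

  cone : Fin m → Fin n → Set
  cone x v = ∃ λ y → Desc (parent T) y x × v ∈ bag y

  comp : Fin m → Fin n → Set
  comp x v = cone x v × ¬ (v ∈ adh x)

  HasAdhesion : ℕ → Set
  HasAdhesion a = (∀ x → ∣ adh x ∣ ≤ a) × (∃ λ x → ∣ adh x ∣ ≡ a)

  InducedE : (Fin n → Set) → Fin n → Fin n → Set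
  InducedE S u v = S u × S v × E u v

  IsRegular : Set
  IsRegular = ∀ x p → parent T x ≡ just p →
      (∃ λ v → mrg x v)
    × (∀ u v → comp x u → comp x v → Walk (InducedE (comp x)) u v)
    × (∀ u → u ∈ adh x → ∃ λ w → comp x w × E u w)

  BVertex : Fin m → Set
  BVertex x = (Σ (Fin n) λ v → v ∈ bag x) ⊎ (Σ (Fin m) λ y → parent T y ≡ just x)

  bgraphE : (x : Fin m) → BVertex x → BVertex x → Set
  bgraphE x (inj₁ (u , _)) (inj₁ (v , _)) = E u v
  bgraphE x (inj₁ (u , _)) (inj₂ (y , _)) = ∃ λ w → comp y w × E u w
  bgraphE x (inj₂ (y , _)) (inj₁ (u , _)) = ∃ λ w → comp y w × E u w
  bgraphE x (inj₂ _) (inj₂ _) = Empty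

{-# OPTIONS --safe #-}
module Submission where

-- Let t' = t ⊔ (a + 2) and take a subdivision of K_t' in bgraph(x). A child node y is adjacent
-- only to vertices of adh(y), of which there are at most a, whereas a branch vertex has
-- t' - 1 ≥ a + 1 distinct neighbours on its paths; so every branch vertex lies in bag(x).
-- Replacing each child y on a path by a path through G[comp(y)], connected by regularity,
-- gives a subdivision of K_t' in G, and it contains one of K_t.

open import Defs
open import Data.Nat using (ℕ; _+_; _⊔_)
open import Data.Fin using (Fin)
open import Data.Fin.Subset using (Subset)
open import Relation.Binary.Definitions using (Symmetric; Irreflexive)
open import Relation.Binary.PropositionalEquality using (_≡_)

open import Axiom.UniquenessOfIdentityProofs.WithK using (uip)
open import Data.Empty using (⊥-elim) renaming (⊥ to Empty)
open import Data.Fin using (zero; suc; _<_; punchIn; inject≤)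
open import Data.Fin.Properties
  using (<-cmp; punchIn-injective; punchInᵢ≢i; inject≤-injective; toℕ-inject≤; suc-injective; 0≢1+n)
  renaming (_≟_ to _≟ᶠ_)
open import Data.Fin.Subset using (_∈_; _-_; ∣_∣)
open import Data.Fin.Subset.Properties
  using (x∈p∧x∉q⇒x∈p─q; x∈p⇒∣p-x∣<∣p∣; x∈⁅y⁆⇒x≡y; x∈p∩q⁺)
open import Data.List using (List; _∷_)
open import Data.List.Membership.Propositional using () renaming (_∈_ to _∈ₗ_)
open import Data.List.Relation.Binary.Subset.Propositional using () renaming (_⊆_ to _⊆ₗ_)
import Data.List.Relation.Unary.All as All
open import Data.List.Relation.Unary.All.Properties.Core using (¬Any⇒All¬)
open import Data.List.Relation.Unary.AllPairs using ([]; _∷_)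
open import Data.List.Relation.Unary.Any using (here; there)
open import Data.Maybe using (Maybe; just)
open import Data.Maybe.Properties using (just-injective)
import Data.Nat as ℕ
open import Data.Nat.Properties using (≤-trans; ≤-pred; +-comm; 1+n≰n; m≤m⊔n; m≤n⊔m)
open import Data.Product using (Σ; ∃; _×_; _,_; proj₁; proj₂)
open import Data.Sum using (_⊎_; inj₁; inj₂)
open import Data.Unit using (⊤; tt)
open import Data.Vec.Properties.WithK using ([]=-irrelevant)
open import Function using (_∘_)
open import Function.Definitions using (Injective)
open import Relation.Binary.Definitions using (DecidableEquality; tri<; tri≈; tri>)
open import Relation.Binary.PropositionalEquality using (_≢_; refl; sym; trans; cong; subst; subst₂)
open import Relation.Nullary using (¬_; yes; no)

module _ {V : Set} {E : V → V → Set} where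

  source∈vertices : ∀ {u w} (p : Walk E u w) → u ∈ₗ vertices p
  source∈vertices [ _ ] = here refl
  source∈vertices (_ ∷ _) = here refl

  target∈vertices : ∀ {u w} (p : Walk E u w) → w ∈ₗ vertices p
  target∈vertices [ _ ] = here refl
  target∈vertices (_ ∷ p) = there (target∈vertices p)

  exceptLast⊆vertices : ∀ {u w} (p : Walk E u w) → exceptLast p ⊆ₗ vertices p
  exceptLast⊆vertices (_ ∷ _) (here z≡u) = here z≡u
  exceptLast⊆vertices (_ ∷ p) (there z∈) = there (exceptLast⊆vertices p z∈)

  interior⊆vertices : ∀ {u w} (p : Walk E u w) → interior p ⊆ₗ vertices p
  interior⊆vertices (_ ∷ p) z∈ = there (exceptLast⊆vertices p z∈)

  exceptLast-excludes-target : ∀ {u w z} (p : Walk E u w) → IsPath p → z ∈ₗ exceptLast p → z ≢ w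
  exceptLast-excludes-target (_ ∷ p) (u∉p ∷ _) (here refl) = All.lookup u∉p (target∈vertices p)
  exceptLast-excludes-target (_ ∷ p) (_ ∷ p-path) (there z∈) = exceptLast-excludes-target p p-path z∈

  interior-excludes-ends : ∀ {u w z} (p : Walk E u w) → IsPath p → z ∈ₗ interior p → z ≢ u × z ≢ w
  interior-excludes-ends (_ ∷ p) (u∉p ∷ p-path) z∈ =
    (λ z≡u → All.lookup u∉p (exceptLast⊆vertices p z∈) (sym z≡u)) ,
    exceptLast-excludes-target p p-path z∈

  ∈vertices⇒∈exceptLast : ∀ {u w z} (p : Walk E u w) → z ∈ₗ vertices p → z ≢ w →
                          z ∈ₗ exceptLast p
  ∈vertices⇒∈exceptLast [ _ ] (here refl) z≢w = ⊥-elim (z≢w refl)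
  ∈vertices⇒∈exceptLast (_ ∷ _) (here z≡u) _ = here z≡u
  ∈vertices⇒∈exceptLast (_ ∷ p) (there z∈) z≢w = there (∈vertices⇒∈exceptLast p z∈ z≢w)

  ∈vertices⇒∈interior : ∀ {u w z} (p : Walk E u w) → z ∈ₗ vertices p → z ≢ u → z ≢ w →
                        z ∈ₗ interior p
  ∈vertices⇒∈interior [ _ ] (here refl) z≢u _ = ⊥-elim (z≢u refl)
  ∈vertices⇒∈interior (_ ∷ _) (here refl) z≢u _ = ⊥-elim (z≢u refl)
  ∈vertices⇒∈interior (_ ∷ p) (there z∈) _ z≢w = ∈vertices⇒∈exceptLast p z∈ z≢w

  source≡target⊎∈exceptLast : ∀ {u w} (p : Walk E u w) → u ≡ w ⊎ u ∈ₗ exceptLast p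
  source≡target⊎∈exceptLast [ _ ] = inj₁ refl
  source≡target⊎∈exceptLast (_ ∷ _) = inj₂ (here refl)

  source-neighbour : ∀ {u w} (p : Walk E u w) → u ≢ w →
                     ∃ λ v → E u v × v ∈ₗ vertices p × (v ≡ w ⊎ v ∈ₗ interior p)
  source-neighbour [ _ ] u≢w = ⊥-elim (u≢w refl)
  source-neighbour (e ∷ p) _ = _ , e , there (source∈vertices p) , source≡target⊎∈exceptLast p

  penultimate : ∀ {u v w} (e : E u v) (p : Walk E v w) → ∃ λ z → E z w × z ∈ₗ exceptLast (e ∷ p)
  penultimate e [ _ ] = _ , e , here refl
  penultimate _ (e ∷ p) with penultimate e p
  ... | z , zw , z∈ = z , zw , there z∈

  target-neighbour : ∀ {u w} (p : Walk E u w) → u ≢ w →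
                     ∃ λ v → E v w × v ∈ₗ vertices p × (v ≡ u ⊎ v ∈ₗ interior p)
  target-neighbour [ _ ] u≢w = ⊥-elim (u≢w refl)
  target-neighbour (e ∷ p) _ with penultimate e p
  ... | v , vw , here refl = v , vw , here refl , inj₁ refl
  ... | v , vw , there v∈ = v , vw , there (exceptLast⊆vertices p v∈) , inj₂ v∈

  infixr 5 _++ʷ_
  _++ʷ_ : ∀ {u v w} → Walk E u v → Walk E v w → Walk E u w
  [ _ ] ++ʷ q = q
  (e ∷ p) ++ʷ q = e ∷ (p ++ʷ q)

  ∈-++ʷ⁻ : ∀ {u v w z} (p : Walk E u v) (q : Walk E v w) →
           z ∈ₗ vertices (p ++ʷ q) → z ∈ₗ vertices p ⊎ z ∈ₗ vertices q
  ∈-++ʷ⁻ [ _ ] q z∈ = inj₂ z∈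
  ∈-++ʷ⁻ (_ ∷ _) q (here z≡u) = inj₁ (here z≡u)
  ∈-++ʷ⁻ (_ ∷ p) q (there z∈) with ∈-++ʷ⁻ p q z∈
  ... | inj₁ z∈p = inj₁ (there z∈p)
  ... | inj₂ z∈q = inj₂ z∈q

  all-vertices-in : ∀ {S : V → Set} {u w z} → (∀ {a b} → E a b → S b) → S u →
                    (p : Walk E u w) → z ∈ₗ vertices p → S z
  all-vertices-in _ Su [ _ ] (here refl) = Su
  all-vertices-in _ Su (_ ∷ _) (here refl) = Su
  all-vertices-in edge-in _ (e ∷ p) (there z∈) = all-vertices-in edge-in (edge-in e) p z∈

  module _ (_≟_ : DecidableEquality V) where
    open import Data.List.Membership.DecPropositional _≟_ using (_∈?_)

    dropUntil : ∀ {u w z} (p : Walk E u w) → z ∈ₗ vertices p → Walk E z w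
    dropUntil [ _ ] (here refl) = [ _ ]
    dropUntil (e ∷ p) (here refl) = e ∷ p
    dropUntil (_ ∷ p) (there z∈) = dropUntil p z∈

    dropUntil-⊆ : ∀ {u w z} (p : Walk E u w) (z∈ : z ∈ₗ vertices p) →
                  vertices (dropUntil p z∈) ⊆ₗ vertices p
    dropUntil-⊆ [ _ ] (here refl) y∈ = y∈
    dropUntil-⊆ (_ ∷ _) (here refl) y∈ = y∈
    dropUntil-⊆ (_ ∷ p) (there z∈) y∈ = there (dropUntil-⊆ p z∈ y∈)

    dropUntil-isPath : ∀ {u w z} (p : Walk E u w) (z∈ : z ∈ₗ vertices p) →
                       IsPath p → IsPath (dropUntil p z∈)
    dropUntil-isPath [ _ ] (here refl) p-path = p-path
    dropUntil-isPath (_ ∷ _) (here refl) p-path = p-path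
    dropUntil-isPath (_ ∷ p) (there z∈) (_ ∷ p-path) = dropUntil-isPath p z∈ p-path

    shortcut : ∀ {u w} (p : Walk E u w) → Σ (Walk E u w) λ q → IsPath q × vertices q ⊆ₗ vertices p
    shortcut [ v ] = [ v ] , (All.[] ∷ []) , λ y∈ → y∈
    shortcut (_∷_ {u = u} e p) with shortcut p
    ... | q , q-path , q⊆p with u ∈? vertices q
    ... | yes u∈q = dropUntil q u∈q , dropUntil-isPath q u∈q q-path ,
                    there ∘ q⊆p ∘ dropUntil-⊆ q u∈q
    ... | no u∉q = e ∷ q , (¬Any⇒All¬ (vertices q) u∉q ∷ q-path) ,
                   λ { (here y≡u) → here y≡u ; (there y∈) → there (q⊆p y∈) }

mapWalk : ∀ {V : Set} {R E : V → V → Set} {u w} → (∀ {a b} → R a b → E a b) →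
          Walk R u w → Walk E u w
mapWalk f [ v ] = [ v ]
mapWalk f (r ∷ p) = f r ∷ mapWalk f p

vertices-mapWalk : ∀ {V : Set} {R E : V → V → Set} {u w}
                   (f : ∀ {a b} → R a b → E a b) (p : Walk R u w) →
                   vertices (mapWalk {E = E} f p) ≡ vertices p
vertices-mapWalk f [ _ ] = refl
vertices-mapWalk f (_ ∷ p) = cong (_ ∷_) (vertices-mapWalk f p)

KTopMinor-≤ : ∀ {V : Set} {E : V → V → Set} {t t'} → t ℕ.≤ t' → KTopMinor E t' → KTopMinor E t
KTopMinor-≤ {t = t} {t'} t≤t' K = record
  { branch = branch ∘ embed
  ; injective = embed-injective ∘ injective
  ; path = λ i j i<j → path (embed i) (embed j) (embed-< i<j)
  ; isPath = λ i j i<j → isPath (embed i) (embed j) (embed-< i<j)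
  ; disjoint = λ i j i' j' i<j i'<j' ends≢ → disjoint _ _ _ _ (embed-< i<j) (embed-< i'<j')
      (λ (i≡i' , j≡j') → ends≢ (embed-injective i≡i' , embed-injective j≡j'))
  }
  where
  open KTopMinor K
  embed : Fin t → Fin t'
  embed i = inject≤ i t≤t'
  embed-injective : ∀ {i j} → embed i ≡ embed j → i ≡ j
  embed-injective = inject≤-injective t≤t' t≤t' _ _
  embed-< : ∀ {i j} → i < j → embed i < embed j
  embed-< {i} {j} = subst₂ ℕ._<_ (sym (toℕ-inject≤ i t≤t')) (sym (toℕ-inject≤ j t≤t'))

module _ {V : Set} {E : V → V → Set} {t : ℕ} (K : KTopMinor E t) where
  open KTopMinor K

  -- The neighbour of branch k on the subdivided edge {k, l}, whichever way that path is oriented.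
  record Spoke (k l : Fin t) : Set where
    field
      i j              : Fin t
      i<j              : i < j
      ends             : (i ≡ k × j ≡ l) ⊎ (i ≡ l × j ≡ k)
      vertex           : V
      adjacent         : E (branch k) vertex ⊎ E vertex (branch k)
      onPath           : vertex ∈ₗ vertices (path i j i<j)
      branchOrInterior : vertex ≡ branch l ⊎ vertex ∈ₗ interior (path i j i<j)

  spoke : ∀ {k l} → k ≢ l → Spoke k l
  spoke {k} {l} k≢l with <-cmp k l
  ... | tri≈ _ k≡l _ = ⊥-elim (k≢l k≡l)
  ... | tri< k<l _ _ with source-neighbour (path k l k<l) (k≢l ∘ injective)
  ...   | v , kv , v∈ , v-end = record
          { i = k ; j = l ; i<j = k<l ; ends = inj₁ (refl , refl) ; vertex = v
          ; adjacent = inj₁ kv ; onPath = v∈ ; branchOrInterior = v-end }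
  spoke {k} {l} k≢l | tri> _ _ l<k with target-neighbour (path l k l<k) (k≢l ∘ sym ∘ injective)
  ...   | v , vk , v∈ , v-end = record
          { i = l ; j = k ; i<j = l<k ; ends = inj₂ (refl , refl) ; vertex = v
          ; adjacent = inj₂ vk ; onPath = v∈ ; branchOrInterior = v-end }

  spokes-use-different-paths : ∀ {k l l'} → k ≢ l → k ≢ l' → l ≢ l' →
                               (A : Spoke k l) (B : Spoke k l') →
                               ¬ (Spoke.i A ≡ Spoke.i B × Spoke.j A ≡ Spoke.j B)
  spokes-use-different-paths k≢l k≢l' l≢l' A B (i≡ , j≡) with Spoke.ends A | Spoke.ends B
  ... | inj₁ (_ , refl) | inj₁ (_ , refl) = l≢l' j≡
  ... | inj₁ (refl , _) | inj₂ (refl , _) = k≢l' i≡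
  ... | inj₂ (refl , _) | inj₁ (refl , _) = k≢l (sym i≡)
  ... | inj₂ (refl , _) | inj₂ (refl , _) = l≢l' i≡

  spoke-vertices-distinct : ∀ {k l l'} → k ≢ l → k ≢ l' → l ≢ l' →
                            (A : Spoke k l) (B : Spoke k l') →
                            Spoke.vertex A ≢ Spoke.vertex B
  spoke-vertices-distinct k≢l k≢l' l≢l' A B v≡v' with Spoke.branchOrInterior A | Spoke.branchOrInterior B
  ... | inj₂ v∈int | _ = disjoint _ _ _ _ _ _ (spokes-use-different-paths k≢l k≢l' l≢l' A B) _ v∈int
                           (subst (_∈ₗ _) (sym v≡v') (Spoke.onPath B))
  ... | inj₁ _ | inj₂ v'∈int = disjoint _ _ _ _ _ _
                           (λ (i≡ , j≡) → spokes-use-different-paths k≢l k≢l' l≢l' A B (sym i≡ , sym j≡))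
                           _ v'∈int
                           (subst (_∈ₗ _) v≡v' (Spoke.onPath A))
  ... | inj₁ v≡l | inj₁ v'≡l' = l≢l' (injective (trans (sym v≡l) (trans v≡v' v'≡l')))

branch-degree : ∀ {V : Set} {E : V → V → Set} {c} (K : KTopMinor E (ℕ.suc c)) (k : Fin (ℕ.suc c)) →
                Σ (Fin c → V) λ nb → Injective _≡_ _≡_ nb ×
                  (∀ j → E (KTopMinor.branch K k) (nb j) ⊎ E (nb j) (KTopMinor.branch K k))
branch-degree K k = Spoke.vertex ∘ spoke-to , nb-injective , Spoke.adjacent ∘ spoke-to
  where
  other≢ : ∀ j → k ≢ punchIn k j
  other≢ j = punchInᵢ≢i k j ∘ sym
  spoke-to : ∀ j → Spoke K k (punchIn k j)
  spoke-to j = spoke K (other≢ j)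
  nb-injective : Injective _≡_ _≡_ (Spoke.vertex ∘ spoke-to)
  nb-injective {i} {j} v≡ with punchIn k i ≟ᶠ punchIn k j
  ... | yes ≡ⱼ = punchIn-injective k i j ≡ⱼ
  ... | no ≢ⱼ =
    ⊥-elim (spoke-vertices-distinct K (other≢ i) (other≢ j) ≢ⱼ (spoke-to i) (spoke-to j) v≡)

injective⇒≤∣p∣ : ∀ {n c} (p : Subset n) {f : Fin c → Fin n} → Injective _≡_ _≡_ f →
                 (∀ i → f i ∈ p) → c ℕ.≤ ∣ p ∣
injective⇒≤∣p∣ {c = ℕ.zero} _ _ _ = ℕ.z≤n
injective⇒≤∣p∣ {c = ℕ.suc c} p {f} f-inj f∈p =
  ≤-trans (ℕ.s≤s (injective⇒≤∣p∣ (p - f zero) (suc-injective ∘ f-inj) rest∈))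
          (x∈p⇒∣p-x∣<∣p∣ (f∈p zero))
  where
  rest∈ : ∀ i → f (suc i) ∈ p - f zero
  rest∈ i = x∈p∧x∉q⇒x∈p─q (f∈p (suc i)) (0≢1+n ∘ sym ∘ f-inj ∘ x∈⁅y⁆⇒x≡y (f zero))

Desc-trans : ∀ {m} {par : Fin m → Maybe (Fin m)} {a b c} → Desc par a b → Desc par b c → Desc par a c
Desc-trans here b↓c = b↓c
Desc-trans (there pa a'↓b) b↓c = there pa (Desc-trans a'↓b b↓c)

module _ {m : ℕ} (T : RootedTree m) where
  private
    _↓_ : Fin m → Fin m → Set
    _↓_ = Desc (parent T)

  cycle-continues : ∀ {y z} → parent T y ≡ just z → z ↓ y →
                    ∃ λ z' → parent T z ≡ just z' × z' ↓ z
  cycle-continues {y} py here = y , py , here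
  cycle-continues py (there pz z'↓y) = _ , pz , Desc-trans z'↓y (there py here)

  parent-not-descendant : ∀ {y x} → parent T y ≡ just x → ¬ (x ↓ y)
  parent-not-descendant {y} = climb (reach-root T y)
    where
    -- Following parents around a cycle never reaches the root.
    climb : ∀ {y z} → y ↓ root T → parent T y ≡ just z → ¬ (z ↓ y)
    climb here py _ with trans (sym (root-parent T)) py
    ... | ()
    climb (there py' z↓root) py z↓y with just-injective (trans (sym py') py)
    ... | refl with cycle-continues py z↓y
    ...   | _ , pz , z'↓z = climb z↓root pz z'↓z

  ascend : ∀ {a y p} → a ↓ y → a ≢ y → parent T a ≡ just p → p ↓ y
  ascend here a≢y _ = ⊥-elim (a≢y refl)
  ascend (there pa' a'↓y) _ pa with just-injective (trans (sym pa') pa)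
  ... | refl = a'↓y

  ancestors-comparable : ∀ {z a b} → z ↓ a → z ↓ b → a ↓ b ⊎ b ↓ a
  ancestors-comparable here z↓b = inj₁ z↓b
  ancestors-comparable (there pz z'↓a) here = inj₂ (there pz z'↓a)
  ancestors-comparable (there pz z'↓a) (there pz' z''↓b) with just-injective (trans (sym pz) pz')
  ... | refl = ancestors-comparable z'↓a z''↓b

  siblings-with-common-descendant : ∀ {x y y' z} → parent T y ≡ just x → parent T y' ≡ just x →
                                    z ↓ y → z ↓ y' → y ≡ y'
  siblings-with-common-descendant py py' z↓y z↓y' with ancestors-comparable z↓y z↓y'
  ... | inj₁ here = refl
  ... | inj₂ here = refl
  ... | inj₁ (there pz y↓') with just-injective (trans (sym pz) py)
  ...   | refl = ⊥-elim (parent-not-descendant py' y↓')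
  siblings-with-common-descendant py py' z↓y z↓y' | inj₂ (there pz y'↓)
    with just-injective (trans (sym pz) py')
  ... | refl = ⊥-elim (parent-not-descendant py y'↓)

  leave-subtree : ∀ {x y s t} {S : Fin m → Set} → parent T y ≡ just x → s ↓ y →
                  Walk (EdgeIn T S) s t → t ↓ y ⊎ (S y × S x)
  leave-subtree _ s↓y [ _ ] = inj₁ s↓y
  leave-subtree {y = y} {s} py s↓y ((Ss , Sp , inj₁ ps) ∷ W) with s ≟ᶠ y
  ... | no s≢y = leave-subtree py (ascend s↓y s≢y ps) W
  ... | yes refl with just-injective (trans (sym ps) py)
  ...   | refl = inj₂ (Ss , Sp)
  leave-subtree py s↓y ((_ , _ , inj₂ pc) ∷ W) = leave-subtree py (there pc s↓y) W

module TreeDecompositionProperties {n m : ℕ} (E : Fin n → Fin n → Set) (T : RootedTree m)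
         (bag : Fin m → Subset n) (TD : IsTreeDecomposition E T bag) where
  open IsTreeDecomposition TD
  private
    _↓_ : Fin m → Fin m → Set
    _↓_ = Desc (parent T)

  ∈adh : ∀ {x y u} → parent T y ≡ just x → u ∈ bag x → u ∈ bag y → u ∈ adh E T bag y
  ∈adh py u∈x u∈y rewrite py = x∈p∩q⁺ (u∈x , u∈y)

  adh-separates : ∀ {x y y' z u} → parent T y ≡ just x → y' ↓ y → u ∈ bag y' → u ∈ bag z →
                  z ↓ y ⊎ u ∈ adh E T bag y
  adh-separates py y'↓y u∈y' u∈z with leave-subtree T py y'↓y (connected _ _ _ u∈y' u∈z)
  ... | inj₁ z↓y = inj₁ z↓y
  ... | inj₂ (u∈y , u∈x) = inj₂ (∈adh py u∈x u∈y)

  comp-bags-below : ∀ {x y z w} → parent T y ≡ just x → comp E T bag y w → w ∈ bag z → z ↓ y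
  comp-bags-below py ((_ , y'↓y , w∈y') , w∉adh) w∈z with adh-separates py y'↓y w∈y' w∈z
  ... | inj₁ z↓y = z↓y
  ... | inj₂ w∈adh = ⊥-elim (w∉adh w∈adh)

  comp∉parentBag : ∀ {x y w} → parent T y ≡ just x → comp E T bag y w → ¬ w ∈ bag x
  comp∉parentBag py w∈comp w∈x = parent-not-descendant T py (comp-bags-below py w∈comp w∈x)

  comps-of-siblings-disjoint : ∀ {x y y' w} → parent T y ≡ just x → parent T y' ≡ just x →
                               comp E T bag y w → comp E T bag y' w → y ≡ y'
  comps-of-siblings-disjoint py py' w∈comp ((_ , y''↓y' , w∈y'') , _) =
    siblings-with-common-descendant T py py' (comp-bags-below py w∈comp w∈y'') y''↓y'

  comp-neighbour∈adh : ∀ {x y u w} → parent T y ≡ just x → u ∈ bag x → comp E T bag y w → E u w →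
                       u ∈ adh E T bag y
  comp-neighbour∈adh py u∈x w∈comp uw with edges _ _ uw
  ... | z , u∈z , w∈z with adh-separates py (comp-bags-below py w∈comp w∈z) u∈z u∈x
  ...   | inj₁ x↓y = ⊥-elim (parent-not-descendant T py x↓y)
  ...   | inj₂ u∈adh = u∈adh

module BagGraph {n m : ℕ} (E : Fin n → Fin n → Set) (E-sym : Symmetric E)
                (T : RootedTree m) (bag : Fin m → Subset n)
                (TD : IsTreeDecomposition E T bag) (regular : IsRegular E T bag) (x : Fin m) where
  open TreeDecompositionProperties E T bag TD

  private
    B : Set
    B = BVertex E T bag x
    _~_ : B → B → Set
    _~_ = bgraphE E T bag x

  Child : Set
  Child = Σ (Fin m) λ y → parent T y ≡ just x

  childVertex-≡ : ∀ {y y'} (py : parent T y ≡ just x) (py' : parent T y' ≡ just x) → y ≡ y' →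
                  _≡_ {A = B} (inj₂ (y , py)) (inj₂ (y' , py'))
  childVertex-≡ py py' refl = cong (λ py → inj₂ (_ , py)) (uip py py')

  IsBag : B → Set
  IsBag (inj₁ _) = ⊤
  IsBag (inj₂ _) = Empty

  bagVertex : (b : B) → IsBag b → Fin n
  bagVertex (inj₁ (u , _)) _ = u

  bagVertex-injective : ∀ b b' (bb : IsBag b) (bb' : IsBag b') → bagVertex b bb ≡ bagVertex b' bb' → b ≡ b'
  bagVertex-injective (inj₁ (u , u∈)) (inj₁ (_ , u∈')) _ _ refl =
    cong (λ u∈ → inj₁ (u , u∈)) ([]=-irrelevant u∈ u∈')

  bagVertex-≢ : ∀ {z z∈ b} (bb : IsBag b) → z ≢ bagVertex b bb → inj₁ (z , z∈) ≢ b
  bagVertex-≢ _ z≢ refl = z≢ refl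

  child≢bag : ∀ {Y b} → IsBag b → inj₂ Y ≢ b
  child≢bag bb refl = bb

  child-neighbour∈adh : ∀ {y py b} → inj₂ (y , py) ~ b ⊎ b ~ inj₂ (y , py) →
                        Σ (IsBag b) λ bb → bagVertex b bb ∈ adh E T bag y
  child-neighbour∈adh {py = py} {inj₁ (_ , u∈)} (inj₁ (_ , w∈comp , uw)) =
    tt , comp-neighbour∈adh py u∈ w∈comp uw
  child-neighbour∈adh {py = py} {inj₁ (_ , u∈)} (inj₂ (_ , w∈comp , uw)) =
    tt , comp-neighbour∈adh py u∈ w∈comp uw
  child-neighbour∈adh {b = inj₂ _} (inj₁ ())
  child-neighbour∈adh {b = inj₂ _} (inj₂ ())

  branches-in-bag : ∀ {a t} → (∀ y → ∣ adh E T bag y ∣ ℕ.≤ a) → a + 2 ℕ.≤ t →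
                    (K : KTopMinor _~_ t) → ∀ k → IsBag (KTopMinor.branch K k)
  branches-in-bag {a} {ℕ.suc c} adh≤a a+2≤t K k with KTopMinor.branch K k | branch-degree K k
  ... | inj₁ _ | _ = tt
  ... | inj₂ (y , py) | nb , nb-injective , nb-adjacent =
    1+n≰n (≤-trans a<c (≤-trans c≤∣adh∣ (adh≤a y)))
    where
    a<c : ℕ.suc a ℕ.≤ c
    a<c = ≤-pred (subst (ℕ._≤ ℕ.suc c) (+-comm a 2) a+2≤t)
    in-adh : ∀ j → Σ (IsBag (nb j)) λ bb → bagVertex (nb j) bb ∈ adh E T bag y
    in-adh = child-neighbour∈adh ∘ nb-adjacent
    c≤∣adh∣ : c ℕ.≤ ∣ adh E T bag y ∣
    c≤∣adh∣ = injective⇒≤∣p∣ (adh E T bag y) {λ j → bagVertex (nb j) (proj₁ (in-adh j))}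
                (nb-injective ∘ bagVertex-injective _ _ _ _) (proj₂ ∘ in-adh)

  comp-walk : ∀ {y w w'} (py : parent T y ≡ just x) → comp E T bag y w → comp E T bag y w' → Walk E w w'
  comp-walk {y} py w∈ w'∈ = mapWalk (λ (_ , _ , e) → e) (proj₁ (proj₂ (regular y x py)) _ _ w∈ w'∈)

  comp-walk-⊆ : ∀ {y w w' z} (py : parent T y ≡ just x)
                (w∈ : comp E T bag y w) (w'∈ : comp E T bag y w') →
                z ∈ₗ vertices (comp-walk py w∈ w'∈) → comp E T bag y z
  comp-walk-⊆ {y} py w∈ w'∈ z∈ =
    all-vertices-in (λ (_ , Sb , _) → Sb) w∈ (proj₁ (proj₂ (regular y x py)) _ _ w∈ w'∈)
      (subst (_ ∈ₗ_) (vertices-mapWalk _ _) z∈)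

  expand : ∀ {s t} (P : Walk _~_ s t) (bs : IsBag s) (bt : IsBag t) → Walk E (bagVertex s bs) (bagVertex t bt)
  expand {inj₁ _} [ _ ] _ _ = [ _ ]
  expand {inj₁ _} (_∷_ {v = inj₁ _} uv P) _ bt = uv ∷ expand P tt bt
  expand {inj₁ _} (_∷_ {v = inj₂ (_ , py)} (_ , w∈ , uw) (_∷_ {v = inj₁ _} (_ , w'∈ , u'w') P)) _ bt =
    uw ∷ (comp-walk py w∈ w'∈ ++ʷ E-sym u'w' ∷ expand P tt bt)
  expand {inj₁ _} (_∷_ {v = inj₂ _} _ [ _ ]) _ ()
  expand {inj₁ _} (_∷_ {v = inj₂ _} _ (_∷_ {v = inj₂ _} () _)) _ _
  expand {inj₂ _} _ () _

  OnExpansion : List B → Fin n → Set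
  OnExpansion bs z = (Σ (z ∈ bag x) λ z∈ → inj₁ (z , z∈) ∈ₗ bs)
                   ⊎ (Σ Child λ Y → inj₂ Y ∈ₗ bs × comp E T bag (proj₁ Y) z)

  onExpansion-∷ : ∀ {b bs z} → OnExpansion bs z → OnExpansion (b ∷ bs) z
  onExpansion-∷ (inj₁ (z∈ , on)) = inj₁ (z∈ , there on)
  onExpansion-∷ (inj₂ (Y , on , z∈comp)) = inj₂ (Y , there on , z∈comp)

  expand-vertices : ∀ {s t z} (P : Walk _~_ s t) (bs : IsBag s) (bt : IsBag t) →
                    z ∈ₗ vertices (expand P bs bt) → OnExpansion (vertices P) z
  expand-vertices {inj₁ (_ , u∈)} [ _ ] _ _ (here refl) = inj₁ (u∈ , here refl)
  expand-vertices {inj₁ (_ , u∈)} (_∷_ {v = inj₁ _} _ P) _ _ (here refl) = inj₁ (u∈ , here refl)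
  expand-vertices {inj₁ _} (_∷_ {v = inj₁ _} _ P) _ bt (there z∈) =
    onExpansion-∷ (expand-vertices P tt bt z∈)
  expand-vertices {inj₁ (_ , u∈)} (_∷_ {v = inj₂ _} _ (_∷_ {v = inj₁ _} _ P)) _ _ (here refl) =
    inj₁ (u∈ , here refl)
  expand-vertices {inj₁ _}
    (_∷_ {v = inj₂ (y , py)} (_ , w∈ , _) (_∷_ {v = inj₁ _} (_ , w'∈ , u'w') P)) _ bt (there z∈)
    with ∈-++ʷ⁻ (comp-walk py w∈ w'∈) (E-sym u'w' ∷ expand P tt bt) z∈
  ... | inj₁ z∈comp = inj₂ ((y , py) , there (here refl) , comp-walk-⊆ py w∈ w'∈ z∈comp)
  ... | inj₂ (here refl) = inj₂ ((y , py) , there (here refl) , w'∈)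
  ... | inj₂ (there z∈') = onExpansion-∷ (onExpansion-∷ (expand-vertices P tt bt z∈'))
  expand-vertices {inj₁ _} (_∷_ {v = inj₂ _} _ [ _ ]) _ ()
  expand-vertices {inj₁ _} (_∷_ {v = inj₂ _} _ (_∷_ {v = inj₂ _} () _)) _ _
  expand-vertices {inj₂ _} _ () _

  expand-interior : ∀ {s t z} (P : Walk _~_ s t) (bs : IsBag s) (bt : IsBag t) →
                    z ∈ₗ vertices (expand P bs bt) → z ≢ bagVertex s bs → z ≢ bagVertex t bt →
                    OnExpansion (interior P) z
  expand-interior P bs bt z∈ z≢s z≢t with expand-vertices P bs bt z∈
  ... | inj₁ (z∈x , on) =
        inj₁ (z∈x , ∈vertices⇒∈interior P on (bagVertex-≢ bs z≢s) (bagVertex-≢ bt z≢t))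
  ... | inj₂ (Y , on , z∈comp) =
        inj₂ (Y , ∈vertices⇒∈interior P on (child≢bag bs) (child≢bag bt) , z∈comp)

  -- Expanded paths stay internally disjoint: comps of distinct children are disjoint and avoid bag x.
  expandTopMinor : ∀ {t} (K : KTopMinor _~_ t) → (∀ k → IsBag (KTopMinor.branch K k)) → KTopMinor E t
  expandTopMinor K in-bag = record
    { branch = branch′
    ; injective = injective ∘ bagVertex-injective _ _ _ _
    ; path = λ i j i<j → proj₁ (route i<j)
    ; isPath = λ i j i<j → proj₁ (proj₂ (route i<j))
    ; disjoint = routes-disjoint
    }
    where
    open KTopMinor K
    branch′ : _ → Fin n
    branch′ k = bagVertex (branch k) (in-bag k)
    expanded : ∀ {i j} (i<j : i < j) → Walk E (branch′ i) (branch′ j)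
    expanded {i} {j} i<j = expand (path i j i<j) (in-bag i) (in-bag j)
    route : ∀ {i j} (i<j : i < j) →
            Σ (Walk E (branch′ i) (branch′ j)) λ q → IsPath q × vertices q ⊆ₗ vertices (expanded i<j)
    route i<j = shortcut _≟ᶠ_ (expanded i<j)
    routes-disjoint : ∀ i j i' j' (i<j : i < j) (i'<j' : i' < j') → ¬ (i ≡ i' × j ≡ j') →
                      ∀ z → z ∈ₗ interior (proj₁ (route i<j)) →
                      ¬ z ∈ₗ vertices (proj₁ (route i'<j'))
    routes-disjoint i j i' j' i<j i'<j' ends≢ z z∈int z∈'
      with interior-excludes-ends (proj₁ (route i<j)) (proj₁ (proj₂ (route i<j))) z∈int
    ... | z≢i , z≢j
      with expand-interior (path i j i<j) (in-bag i) (in-bag j)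
             (proj₂ (proj₂ (route i<j)) (interior⊆vertices _ z∈int)) z≢i z≢j
         | expand-vertices (path i' j' i'<j') (in-bag i') (in-bag j') (proj₂ (proj₂ (route i'<j')) z∈')
    ... | inj₁ (z∈x , int) | inj₁ (z∈x' , on) =
          disjoint i j i' j' i<j i'<j' ends≢ _ int
            (subst (_∈ₗ vertices (path i' j' i'<j')) (bagVertex-injective _ _ tt tt refl) on)
    ... | inj₁ (z∈x , _) | inj₂ ((_ , py) , _ , z∈comp) = comp∉parentBag py z∈comp z∈x
    ... | inj₂ ((_ , py) , _ , z∈comp) | inj₁ (z∈x , _) = comp∉parentBag py z∈comp z∈x
    ... | inj₂ ((_ , py) , int , z∈comp) | inj₂ ((_ , py') , on , z∈comp') =
          disjoint i j i' j' i<j i'<j' ends≢ _ int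
            (subst (_∈ₗ vertices (path i' j' i'<j'))
                   (sym (childVertex-≡ py py' (comps-of-siblings-disjoint py py' z∈comp z∈comp'))) on)

lemma3p5 : ∀ {n m : ℕ} (E : Fin n → Fin n → Set) → Symmetric E → Irreflexive _≡_ E →
           (T : RootedTree m) (bag : Fin m → Subset n) →
           IsTreeDecomposition E T bag → IsRegular E T bag →
           (a : ℕ) → HasAdhesion E T bag a →
           (t : ℕ) → TopMinorFree E t →
           ∀ x → TopMinorFree (bgraphE E T bag x) (t ⊔ (a + 2))
lemma3p5 E E-sym _ T bag TD regular a (adh≤a , _) t free x K =
  free (KTopMinor-≤ (m≤m⊔n t (a + 2)) (expandTopMinor K (branches-in-bag adh≤a (m≤n⊔m t (a + 2)) K)))
  where open BagGraph E E-sym T bag TD regular x
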